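{- Let $n$ be an odd positive integer and let $\mathcal{B}$ be a balanced bipartite graph on $2n$ vertices with parts $V_1$ and $V_2$ (each of size $n$), such that $\delta(\mathcal{B})\geq \frac{n+1}{2}$ and $$\max\Big\{\big|\{v\in V_1: d_{\mathcal{B}}(v)=\tfrac{n+1}{2}\}\big|,\ \big|\{u\in V_2: d_{\mathcal{B}}(u)=\tfrac{n+1}{2}\}\big|\Big\}\leq 1.$$ Then $f(\mathcal{B})=n+1$.
   Context: All graphs are finite and simple. A balanced bipartite graph on $2n$ vertices is a bipartite graph with bipartition $V_1,V_2$, $|V_1|=|V_2|=n$. $d_G(v)$ is the degree of $v$ and $\delta(G)$ the minimum degree. The forest number $f(G)$ is the maximum cardinality of a set $S\subseteq V(G)$ such that the induced subgraph $G[S]$ is a forest. -}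

module Defs where

open import Data.Nat using (ℕ; suc; _+_; _≤_)
open import Data.Bool using (Bool; true; false)
open import Data.Fin using (Fin)
open import Data.Fin.Subset using (Subset; _∈_; ∣_∣)
open import Data.Vec using (tabulate)
open import Data.Sum using (_⊎_; inj₁; inj₂)
open import Data.Empty using (⊥)
open import Data.Product using (Σ; _×_; ∃)
open import Data.List using (List; []; _∷_; length)
open import Data.List.Relation.Unary.All using (All)
open import Data.List.Relation.Unary.Unique.Propositional using (Unique)
open import Relation.Binary.PropositionalEquality using (_≡_)
open import Relation.Nullary using (¬_)
open import Relation.Nullary.Decidable using (⌊_⌋)
import Data.Nat
import Data.Maybe
import Data.List

-- A balanced bipartite graph on 2n vertices with parts V₁ = V₂ = Fin n,
-- given by its biadjacency matrix: E i j = true iff i ∈ V₁ is adjacent to j ∈ V₂.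
BipGraph : ℕ → Set
BipGraph n = Fin n → Fin n → Bool

Vertex : ℕ → Set
Vertex n = Fin n ⊎ Fin n

Adj : ∀ {n} → BipGraph n → Vertex n → Vertex n → Set
Adj E (inj₁ i) (inj₂ j) = E i j ≡ true
Adj E (inj₂ j) (inj₁ i) = E i j ≡ true
Adj E (inj₁ _) (inj₁ _) = ⊥
Adj E (inj₂ _) (inj₂ _) = ⊥

deg₁ : ∀ {n} → BipGraph n → Fin n → ℕ
deg₁ E i = ∣ tabulate (λ j → E i j) ∣

deg₂ : ∀ {n} → BipGraph n → Fin n → ℕ
deg₂ E j = ∣ tabulate (λ i → E i j) ∣

countDeg₁ : ∀ {n} → BipGraph n → ℕ → ℕ
countDeg₁ E d = ∣ tabulate (λ i → ⌊ Data.Nat._≟_ (deg₁ E i) d ⌋) ∣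

countDeg₂ : ∀ {n} → BipGraph n → ℕ → ℕ
countDeg₂ E d = ∣ tabulate (λ j → ⌊ Data.Nat._≟_ (deg₂ E j) d ⌋) ∣

VSet : ℕ → Set
VSet n = Subset n × Subset n

_∈V_ : ∀ {n} → Vertex n → VSet n → Set
inj₁ i ∈V (S₁ Data.Product., _) = i ∈ S₁
inj₂ j ∈V (_ Data.Product., S₂) = j ∈ S₂

size : ∀ {n} → VSet n → ℕ
size (S₁ Data.Product., S₂) = ∣ S₁ ∣ + ∣ S₂ ∣

data Walk {n} (E : BipGraph n) : List (Vertex n) → Set where
  one  : ∀ v → Walk E (v ∷ [])
  cons : ∀ u v vs → Adj E u v → Walk E (v ∷ vs) → Walk E (u ∷ v ∷ vs)

record CycleIn {n} (E : BipGraph n) (S : VSet n) : Set where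
  field
    first : Vertex n
    rest  : List (Vertex n)
    last  : Vertex n
    long  : 3 ≤ length (first ∷ rest)
    walk  : Walk E (first ∷ rest)
    lastIsLast : Data.List.last (first ∷ rest) ≡ Data.Maybe.just last
    closes : Adj E last first
    distinct : Unique (first ∷ rest)
    inS : All (λ v → v ∈V S) (first ∷ rest)

IsForest : ∀ {n} → BipGraph n → VSet n → Set
IsForest E S = ¬ CycleIn E S

ForestNumber : ∀ {n} → BipGraph n → ℕ → Set
ForestNumber E m =
  (Σ (VSet _) λ S → IsForest E S × size S ≡ m)
  × (∀ S → IsForest E S → size S ≤ m)

-- Let S = S₁ ∪ S₂ with |S| ≥ n + 2. One part, say S₂, has at least (n+3)/2 vertices, so a
-- vertex of S₁ has at most n − |S₂| neighbours outside S₂; since all degrees are at least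
-- (n+1)/2 and at most one equals (n+1)/2, summing over S₁ shows that S spans at least |S|
-- edges, hence G[S] contains a cycle.  Conversely one vertex of V₁ together with all of V₂
-- induces a star, which attains the bound.

module Submission where

open import Defs
open import Data.Nat using (ℕ; suc; _+_; _*_; _≤_)

open import Data.Bool using (Bool; true; false; not; _∧_) renaming (_≟_ to _≟ᵇ_)
open import Data.Empty using (⊥-elim)
open import Data.Fin using (Fin; zero; suc; join; splitAt) renaming (_≟_ to _≟ᶠ_)
open import Data.Fin.Properties using (punchInᵢ≢i; any?; injective⇒≤; splitAt-join)
open import Data.Fin.Subset using (Subset; ∣_∣; ⁅_⁆; ⊤)
open import Data.Fin.Subset.Properties using (∣⊤∣≡n; ∣⊥∣≡0; x∈⁅y⁆⇒x≡y)
open import Data.List using (List; []; _∷_; length; last)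
import Data.List as List
open import Data.List.Membership.Propositional using (_∈_)
open import Data.List.Membership.Propositional.Properties using (∈-lookup)
open import Data.List.Relation.Unary.All as All using (All; []; _∷_)
open import Data.List.Relation.Unary.All.Properties.Core using (¬Any⇒All¬)
open import Data.List.Relation.Unary.AllPairs using ([]; _∷_)
open import Data.List.Relation.Unary.Any using (here; there)
open import Data.List.Relation.Unary.Unique.Propositional using (Unique)
open import Data.Maybe using (just)
open import Data.Nat using (zero; _<_; z≤n; s≤s; s≤s⁻¹; _≟_; _≤?_)
open import Data.Nat.Properties
open import Data.Nat.Tactic.RingSolver using (solve-∀)
open import Data.Product using (∃; ∃₂; _×_; _,_; proj₁; proj₂)
open import Data.Sum using (_⊎_; inj₁; inj₂)
open import Data.Sum.Properties using (≡-dec; inj₁-injective; inj₂-injective)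
open import Data.Vec using (tabulate; lookup)
open import Data.Vec.Properties using (tabulate∘lookup; lookup⇒[]=)
open import Data.Vec.Functional using (updateAt; removeAt)
open import Data.Vec.Functional.Properties using (updateAt-updates; updateAt-minimal)
open import Function using (_∘_)
open import Relation.Binary.Definitions using (DecidableEquality)
open import Relation.Binary.PropositionalEquality
  using (_≡_; _≢_; refl; sym; trans; cong; cong₂; subst; subst₂; module ≡-Reasoning)
open import Relation.Nullary using (¬_; yes; no)
open import Relation.Nullary.Decidable using (⌊_⌋; _×-dec_)

open import Algebra.Properties.CommutativeSemigroup +-commutativeSemigroup using (xy∙z≈zy∙x)
open import Algebra.Properties.Semiring.Sum +-*-semiring
  using (sum; sum-cong-≗; sum-remove; ∑-distrib-+; ∑-comm; *-distribˡ-sum; *-distribʳ-sum)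

[_] : Bool → ℕ
[ true ] = 1
[ false ] = 0

[b]≤1 : ∀ b → [ b ] ≤ 1
[b]≤1 true  = s≤s z≤n
[b]≤1 false = z≤n

[b]*m≤m : ∀ b m → [ b ] * m ≤ m
[b]*m≤m true  m = ≤-reflexive (+-identityʳ m)
[b]*m≤m false m = z≤n

card : ∀ {n} → (Fin n → Bool) → ℕ
card s = sum (λ i → [ s i ])

sumOver : ∀ {n} → (Fin n → Bool) → (Fin n → ℕ) → ℕ
sumOver s f = sum (λ i → [ s i ] * f i)

remove : ∀ {n} → Fin n → (Fin n → Bool) → Fin n → Bool
remove i s = updateAt s i (λ _ → false)

sum-mono-≤ : ∀ {n} {f g : Fin n → ℕ} → (∀ i → f i ≤ g i) → sum f ≤ sum g
sum-mono-≤ {zero}  f≤g = z≤n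
sum-mono-≤ {suc n} f≤g = +-mono-≤ (f≤g zero) (sum-mono-≤ (f≤g ∘ suc))

sum-pos : ∀ {n} (f : Fin n → ℕ) → 0 < sum f → ∃ λ i → 0 < f i
sum-pos {suc n} f 0<Σf with f zero in eq
... | suc _ = zero , subst (0 <_) (sym eq) (s≤s z≤n)
... | zero  = let i , 0<fi = sum-pos (f ∘ suc) 0<Σf in suc i , 0<fi

sum-≗-except : ∀ {n} {f g : Fin n → ℕ} i → (∀ j → j ≢ i → f j ≡ g j) → sum f + g i ≡ sum g + f i
sum-≗-except {suc n} {f} {g} i f≡g = begin
  sum f + g i                         ≡⟨ cong (_+ g i) (sum-remove {i = i} f) ⟩
  f i + sum (removeAt f i) + g i      ≡⟨ cong (λ x → f i + x + g i) (sum-cong-≗ (λ j → f≡g _ (punchInᵢ≢i i j))) ⟩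
  f i + sum (removeAt g i) + g i      ≡⟨ xy∙z≈zy∙x (f i) _ (g i) ⟩
  g i + sum (removeAt g i) + f i      ≡⟨ cong (_+ f i) (sum-remove {i = i} g) ⟨
  sum g + f i                         ∎
  where open ≡-Reasoning

∣tabulate∣≡card : ∀ {n} (s : Fin n → Bool) → ∣ tabulate s ∣ ≡ card s
∣tabulate∣≡card {zero}  s = refl
∣tabulate∣≡card {suc n} s with s zero
... | true  = cong suc (∣tabulate∣≡card (s ∘ suc))
... | false = ∣tabulate∣≡card (s ∘ suc)

∣p∣≡card : ∀ {n} (p : Subset n) → ∣ p ∣ ≡ card (lookup p)
∣p∣≡card p = trans (cong ∣_∣ (sym (tabulate∘lookup p))) (∣tabulate∣≡card (lookup p))

card+card-not : ∀ {n} (s : Fin n → Bool) → card s + card (not ∘ s) ≡ n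
card+card-not {zero}  s = refl
card+card-not {suc n} s with s zero
... | true  = cong suc (card+card-not (s ∘ suc))
... | false = trans (+-suc _ _) (cong suc (card+card-not (s ∘ suc)))

card-remove : ∀ {n} (s : Fin n → Bool) i → card s ≡ card (remove i s) + [ s i ]
card-remove s i = begin
  card s                          ≡⟨ +-identityʳ (card s) ⟨
  card s + 0                      ≡⟨ cong (λ b → card s + [ b ]) (updateAt-updates i s) ⟨
  card s + [ remove i s i ]       ≡⟨ sum-≗-except i (λ j j≢i → cong [_] (updateAt-minimal j i s j≢i)) ⟨
  card (remove i s) + [ s i ]     ∎
  where open ≡-Reasoning

card-remove-member : ∀ {n} (s : Fin n → Bool) {i} → s i ≡ true → card s ≡ suc (card (remove i s))
card-remove-member s {i} sᵢ =
  trans (card-remove s i) (trans (cong (λ b → card (remove i s) + [ b ]) sᵢ) (+-comm _ 1))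

remove-self : ∀ {n} (s : Fin n → Bool) i → remove i s i ≢ true
remove-self s i r with trans (sym (updateAt-updates i s)) r
... | ()

remove-⊆ : ∀ {n} (s : Fin n → Bool) i j → remove i s j ≡ true → s j ≡ true
remove-⊆ s i j r with j ≟ᶠ i
... | yes refl = ⊥-elim (remove-self s i r)
... | no j≢i = trans (sym (updateAt-minimal j i s j≢i)) r

card-pos : ∀ {n} (s : Fin n → Bool) → 0 < card s → ∃ λ i → s i ≡ true
card-pos s 0<card with sum-pos _ 0<card
... | i , 0<[sᵢ] = i , 0<[b]⇒b (s i) 0<[sᵢ]
  where
  0<[b]⇒b : ∀ b → 0 < [ b ] → b ≡ true
  0<[b]⇒b true _ = refl

another-member : ∀ {n} (s : Fin n → Bool) → 2 ≤ card s → ∀ i → ∃ λ j → j ≢ i × s j ≡ true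
another-member s 2≤card i with card-pos (remove i s) (+-cancelʳ-≤ 1 1 _ (≤-trans 2≤card bound))
  where
  bound : card s ≤ card (remove i s) + 1
  bound = subst (_≤ card (remove i s) + 1) (sym (card-remove s i)) (+-monoʳ-≤ _ ([b]≤1 (s i)))
... | j , rⱼ = j , (λ { refl → remove-self s i rⱼ }) , remove-⊆ s i j rⱼ

sumOver-remove : ∀ {n} (s : Fin n → Bool) (f : Fin n → ℕ) i →
                 sumOver s f ≡ sumOver (remove i s) f + [ s i ] * f i
sumOver-remove s f i = begin
  sumOver s f                             ≡⟨ +-identityʳ (sumOver s f) ⟨
  sumOver s f + [ false ] * f i           ≡⟨ cong (λ b → sumOver s f + [ b ] * f i) (updateAt-updates i s) ⟨
  sumOver s f + [ remove i s i ] * f i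
    ≡⟨ sum-≗-except i (λ j j≢i → cong (λ b → [ b ] * f j) (updateAt-minimal j i s j≢i)) ⟨
  sumOver (remove i s) f + [ s i ] * f i  ∎
  where open ≡-Reasoning

sumOver-+ : ∀ {n} (s : Fin n → Bool) (f g : Fin n → ℕ) →
            sumOver s (λ i → f i + g i) ≡ sumOver s f + sumOver s g
sumOver-+ s f g = trans (sum-cong-≗ (λ i → *-distribˡ-+ [ s i ] (f i) (g i)))
                        (∑-distrib-+ (λ i → [ s i ] * f i) (λ i → [ s i ] * g i))

sumOver-const : ∀ {n} (s : Fin n → Bool) c → sumOver s (λ _ → c) ≡ card s * c
sumOver-const s c = sym (*-distribʳ-sum c (λ i → [ s i ]))

sumOver-mono-≤ : ∀ {n} (s : Fin n → Bool) {f g : Fin n → ℕ} →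
                 (∀ i → s i ≡ true → f i ≤ g i) → sumOver s f ≤ sumOver s g
sumOver-mono-≤ s {f} {g} f≤g = sum-mono-≤ pointwise
  where
  pointwise : ∀ i → [ s i ] * f i ≤ [ s i ] * g i
  pointwise i with s i in sᵢ
  ... | true  = +-monoˡ-≤ 0 (f≤g i sᵢ)
  ... | false = z≤n

sumOver-pos : ∀ {n} (s : Fin n → Bool) (f : Fin n → ℕ) → 0 < sumOver s f → ∃ λ i → s i ≡ true × 0 < f i
sumOver-pos s f 0<Σ with sum-pos _ 0<Σ
... | i , 0<term with s i in sᵢ
...   | true = i , sᵢ , subst (0 <_) (+-identityʳ (f i)) 0<term

suc≤+[≟] : ∀ {d D} → d ≤ D → suc d ≤ D + [ ⌊ D ≟ d ⌋ ]
suc≤+[≟] {d} {D} d≤D with D ≟ d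
... | yes refl = ≤-reflexive (+-comm 1 d)
... | no D≢d   = ≤-trans (≤∧≢⇒< d≤D (D≢d ∘ sym)) (m≤m+n D 0)

card*suc≤sumOver : ∀ {n} d (D : Fin n → ℕ) → (∀ i → d ≤ D i) → (s : Fin n → Bool) →
                   card s * suc d ≤ sumOver s D + card (λ i → ⌊ D i ≟ d ⌋)
card*suc≤sumOver d D d≤D s = begin
  card s * suc d                                  ≡⟨ sumOver-const s (suc d) ⟨
  sum (λ i → [ s i ] * suc d)                     ≤⟨ sum-mono-≤ pointwise ⟩
  sum (λ i → [ s i ] * D i + [ ⌊ D i ≟ d ⌋ ])     ≡⟨ ∑-distrib-+ (λ i → [ s i ] * D i) (λ i → [ ⌊ D i ≟ d ⌋ ]) ⟩
  sumOver s D + card (λ i → ⌊ D i ≟ d ⌋)          ∎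
  where
  open ≤-Reasoning
  pointwise : ∀ i → [ s i ] * suc d ≤ [ s i ] * D i + [ ⌊ D i ≟ d ⌋ ]
  pointwise i with s i
  ... | true  = subst₂ (λ x y → x ≤ y + [ ⌊ D i ≟ d ⌋ ]) (sym (+-identityʳ (suc d))) (sym (+-identityʳ (D i)))
                  (suc≤+[≟] (d≤D i))
  ... | false = z≤n

card≤card-∧+card-not : ∀ {n} (f g : Fin n → Bool) → card g ≤ card (λ j → f j ∧ g j) + card (not ∘ f)
card≤card-∧+card-not f g = ≤-trans (sum-mono-≤ (λ j → pointwise (f j) (g j)))
                                    (≤-reflexive (∑-distrib-+ (λ j → [ f j ∧ g j ]) (λ j → [ not (f j) ])))
  where
  pointwise : ∀ a b → [ b ] ≤ [ a ∧ b ] + [ not a ]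
  pointwise true  b = ≤-reflexive (sym (+-identityʳ [ b ]))
  pointwise false b = [b]≤1 b

-- Transposing swaps V₁ and V₂: deg₁ (E ᵀ) and countDeg₁ (E ᵀ) are definitionally deg₂ E
-- and countDeg₂ E, so every statement about V₁ also covers V₂.
_ᵀ : ∀ {n} → BipGraph n → BipGraph n
(E ᵀ) i j = E j i

degIn : ∀ {n} → BipGraph n → (Fin n → Bool) → Fin n → ℕ
degIn E s₂ i = card (λ j → s₂ j ∧ E i j)

edges : ∀ {n} → BipGraph n → (Fin n → Bool) → (Fin n → Bool) → ℕ
edges E s₁ s₂ = sumOver s₁ (degIn E s₂)

edges-transpose : ∀ {n} (E : BipGraph n) s₁ s₂ → edges E s₁ s₂ ≡ edges (E ᵀ) s₂ s₁
edges-transpose E s₁ s₂ = begin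
  sum (λ i → [ s₁ i ] * sum (λ j → [ s₂ j ∧ E i j ]))
    ≡⟨ sum-cong-≗ (λ i → *-distribˡ-sum [ s₁ i ] (λ j → [ s₂ j ∧ E i j ])) ⟩
  sum (λ i → sum (λ j → [ s₁ i ] * [ s₂ j ∧ E i j ]))
    ≡⟨ ∑-comm (λ i j → [ s₁ i ] * [ s₂ j ∧ E i j ]) ⟩
  sum (λ j → sum (λ i → [ s₁ i ] * [ s₂ j ∧ E i j ]))
    ≡⟨ sum-cong-≗ (λ j → sum-cong-≗ (λ i → swap (s₁ i) (s₂ j) (E i j))) ⟩
  sum (λ j → sum (λ i → [ s₂ j ] * [ s₁ i ∧ E i j ]))
    ≡⟨ sum-cong-≗ (λ j → *-distribˡ-sum [ s₂ j ] (λ i → [ s₁ i ∧ E i j ])) ⟨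
  sum (λ j → [ s₂ j ] * sum (λ i → [ s₁ i ∧ E i j ]))
    ∎
  where
  open ≡-Reasoning
  swap : ∀ a b e → [ a ] * [ b ∧ e ] ≡ [ b ] * [ a ∧ e ]
  swap true  true  e = refl
  swap true  false e = refl
  swap false true  e = refl
  swap false false e = refl

edges≤card*card : ∀ {n} (E : BipGraph n) s₁ s₂ → edges E s₁ s₂ ≤ card s₁ * card s₂
edges≤card*card E s₁ s₂ = begin
  sumOver s₁ (degIn E s₂)       ≤⟨ sumOver-mono-≤ s₁ (λ i _ → sum-mono-≤ (λ j → [∧]≤ (s₂ j) (E i j))) ⟩
  sumOver s₁ (λ _ → card s₂)    ≡⟨ sumOver-const s₁ (card s₂) ⟩
  card s₁ * card s₂             ∎
  where
  open ≤-Reasoning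
  [∧]≤ : ∀ a b → [ a ∧ b ] ≤ [ a ]
  [∧]≤ true  b = [b]≤1 b
  [∧]≤ false b = z≤n

edges-remove₁ : ∀ {n} (E : BipGraph n) s₁ s₂ i → degIn E s₂ i ≤ 1 →
                edges E s₁ s₂ ≤ suc (edges E (remove i s₁) s₂)
edges-remove₁ E s₁ s₂ i dᵢ≤1 = begin
  edges E s₁ s₂                                   ≡⟨ sumOver-remove s₁ (degIn E s₂) i ⟩
  edges E (remove i s₁) s₂ + [ s₁ i ] * degIn E s₂ i  ≤⟨ +-monoʳ-≤ _ (≤-trans ([b]*m≤m (s₁ i) _) dᵢ≤1) ⟩
  edges E (remove i s₁) s₂ + 1                    ≡⟨ +-comm _ 1 ⟩
  suc (edges E (remove i s₁) s₂)                  ∎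
  where open ≤-Reasoning

edges-remove₂ : ∀ {n} (E : BipGraph n) s₁ s₂ j → degIn (E ᵀ) s₁ j ≤ 1 →
                edges E s₁ s₂ ≤ suc (edges E s₁ (remove j s₂))
edges-remove₂ E s₁ s₂ j dⱼ≤1 = begin
  edges E s₁ s₂                        ≡⟨ edges-transpose E s₁ s₂ ⟩
  edges (E ᵀ) s₂ s₁                    ≤⟨ edges-remove₁ (E ᵀ) s₂ s₁ j dⱼ≤1 ⟩
  suc (edges (E ᵀ) (remove j s₂) s₁)   ≡⟨ cong suc (edges-transpose E s₁ (remove j s₂)) ⟨
  suc (edges E s₁ (remove j s₂))       ∎
  where open ≤-Reasoning

∧≡true : ∀ {a b} → a ∧ b ≡ true → a ≡ true × b ≡ true
∧≡true {true} {true} refl = refl , refl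

0<edges⇒edge : ∀ {n} (E : BipGraph n) s₁ s₂ → 0 < edges E s₁ s₂ →
               ∃₂ λ i j → s₁ i ≡ true × s₂ j ≡ true × E i j ≡ true
0<edges⇒edge E s₁ s₂ 0<e with sumOver-pos s₁ (degIn E s₂) 0<e
... | i , s₁ᵢ , 0<dᵢ with card-pos _ 0<dᵢ
...   | j , sⱼ∧eᵢⱼ = i , j , s₁ᵢ , ∧≡true sⱼ∧eᵢⱼ

module _ {A : Set} where

  Unique⇒lookup-injective : ∀ {xs : List A} → Unique xs →
                            ∀ i j → List.lookup xs i ≡ List.lookup xs j → i ≡ j
  Unique⇒lookup-injective (_ ∷ _)    zero    zero    _  = refl
  Unique⇒lookup-injective (x≢ ∷ _)   zero    (suc j) eq = ⊥-elim (All.lookup x≢ (∈-lookup j) eq)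
  Unique⇒lookup-injective (x≢ ∷ _)   (suc i) zero    eq = ⊥-elim (All.lookup x≢ (∈-lookup i) (sym eq))
  Unique⇒lookup-injective (_ ∷ uniq) (suc i) (suc j) eq = cong suc (Unique⇒lookup-injective uniq i j eq)

  prefixTo : ∀ {w} (xs : List A) → w ∈ xs → List A
  prefixTo (x ∷ _)  (here _)  = x ∷ []
  prefixTo (x ∷ xs) (there p) = x ∷ prefixTo xs p

  last-prefixTo : ∀ {w} (xs : List A) (p : w ∈ xs) → last (prefixTo xs p) ≡ just w
  last-prefixTo (x ∷ _)      (here refl)        = refl
  last-prefixTo (x ∷ y ∷ _)  (there (here refl)) = refl
  last-prefixTo (x ∷ y ∷ ys) (there (there p))  = last-prefixTo (y ∷ ys) (there p)

  All-prefixTo : ∀ {P : A → Set} {w} (xs : List A) (p : w ∈ xs) → All P xs → All P (prefixTo xs p)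
  All-prefixTo (x ∷ _)  (here _)  (px ∷ _)   = px ∷ []
  All-prefixTo (x ∷ xs) (there p) (px ∷ pxs) = px ∷ All-prefixTo xs p pxs

  Unique-prefixTo : ∀ {w} (xs : List A) (p : w ∈ xs) → Unique xs → Unique (prefixTo xs p)
  Unique-prefixTo (x ∷ _)  (here _)  (_ ∷ _)       = [] ∷ []
  Unique-prefixTo (x ∷ xs) (there p) (x∉ ∷ uniq)   = All-prefixTo xs p x∉ ∷ Unique-prefixTo xs p uniq

Walk-prefixTo : ∀ {n} {E : BipGraph n} {w} (xs : List (Vertex n)) (p : w ∈ xs) →
                Walk E xs → Walk E (prefixTo xs p)
Walk-prefixTo (x ∷ _)      (here _)          _                = one x
Walk-prefixTo (x ∷ y ∷ _)  (there (here _))  (cons _ _ _ e _) = cons x y [] e (one y)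
Walk-prefixTo (x ∷ y ∷ ys) (there (there p)) (cons _ _ _ e w) =
  cons x y _ e (Walk-prefixTo (y ∷ ys) (there p) w)

Unique⇒length≤ : ∀ {n} {xs : List (Vertex n)} → Unique xs → length xs ≤ n + n
Unique⇒length≤ {n} {xs} uniq =
  injective⇒≤ {f = join n n ∘ List.lookup xs}
    (λ {i} {j} eq → Unique⇒lookup-injective uniq i j (join-injective eq))
  where
  join-injective : ∀ {u v : Vertex n} → join n n u ≡ join n n v → u ≡ v
  join-injective {u} {v} eq =
    trans (sym (splitAt-join n n u)) (trans (cong (splitAt n) eq) (splitAt-join n n v))

module _ {n : ℕ} (E : BipGraph n) where

  adj-sym : ∀ {u v} → Adj E u v → Adj E v u
  adj-sym {inj₁ _} {inj₂ _} e = e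
  adj-sym {inj₂ _} {inj₁ _} e = e

  adj-irrefl : ∀ {u} → ¬ Adj E u u
  adj-irrefl {inj₁ _} ()
  adj-irrefl {inj₂ _} ()

  _≟V_ : DecidableEquality (Vertex n)
  _≟V_ = ≡-dec _≟ᶠ_ _≟ᶠ_

  open import Data.List.Membership.DecPropositional _≟V_ using (_∈?_)

  Branching : (Vertex n → Set) → Set
  Branching Q = ∀ {v u} → Q v → Q u → Adj E v u → ∃ λ w → Q w × Adj E v w × w ≢ u

  module _ (S : VSet n) (Q : Vertex n → Set) (Q⊆S : ∀ {v} → Q v → v ∈V S) (branch : Branching Q) where

    -- The walk is stored newest vertex first and stays a path until the next vertex
    -- repeats an earlier one, which closes a cycle; a path has at most n + n vertices.
    private
      grow : (fuel : ℕ) (v₀ v₁ : Vertex n) (vs : List (Vertex n)) →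
             Walk E (v₀ ∷ v₁ ∷ vs) → Unique (v₀ ∷ v₁ ∷ vs) → All Q (v₀ ∷ v₁ ∷ vs) →
             n + n < length (v₀ ∷ v₁ ∷ vs) + fuel → CycleIn E S
      grow fuel v₀ v₁ vs walk@(cons _ _ _ e₀₁ _) uniq qs@(q₀ ∷ q₁ ∷ _) room
        with branch q₀ q₁ e₀₁
      ... | w , q , e₀w , w≢v₁ with w ∈? (v₀ ∷ v₁ ∷ vs)
      ... | yes (here w≡v₀)       = ⊥-elim (adj-irrefl (subst (Adj E v₀) w≡v₀ e₀w))
      ... | yes (there (here w≡v₁)) = ⊥-elim (w≢v₁ w≡v₁)
      ... | yes p@(there (there p′)) = record
        { first      = v₀
        ; rest       = v₁ ∷ prefixTo vs p′
        ; last       = w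
        ; long       = s≤s (s≤s (nonempty vs p′))
        ; walk       = Walk-prefixTo _ p walk
        ; lastIsLast = last-prefixTo _ p
        ; closes     = adj-sym e₀w
        ; distinct   = Unique-prefixTo _ p uniq
        ; inS        = All.map Q⊆S (All-prefixTo _ p qs)
        }
        where
        nonempty : ∀ {w} (xs : List (Vertex n)) (p : w ∈ xs) → 1 ≤ length (prefixTo xs p)
        nonempty (_ ∷ _) (here _)  = s≤s z≤n
        nonempty (_ ∷ _) (there _) = s≤s z≤n
      ... | no w∉ with fuel
      ...   | zero   = ⊥-elim (<⇒≱ (subst (n + n <_) (+-identityʳ _) room) (Unique⇒length≤ uniq))
      ...   | suc f  = grow f w v₀ (v₁ ∷ vs) (cons w v₀ _ (adj-sym e₀w) walk)
                         (¬Any⇒All¬ _ w∉ ∷ uniq) (q ∷ qs) (subst (n + n <_) (+-suc _ f) room)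

    cycle-from-branching : ∀ {v u} → Q v → Q u → Adj E v u → CycleIn E S
    cycle-from-branching {v} {u} qᵥ qᵤ e =
      grow (n + n) v u [] (cons v u [] e (one u)) ((v≢u ∷ []) ∷ [] ∷ []) (qᵥ ∷ qᵤ ∷ []) (n≤1+n _)
      where
      v≢u : v ≢ u
      v≢u v≡u = adj-irrefl (subst (Adj E v) (sym v≡u) e)

Member : ∀ {n} → (Fin n → Bool) → (Fin n → Bool) → Vertex n → Set
Member s₁ s₂ (inj₁ i) = s₁ i ≡ true
Member s₁ s₂ (inj₂ j) = s₂ j ≡ true

m+n≡1⇒m*n≡0 : ∀ {m n} → m + n ≡ 1 → m * n ≡ 0
m+n≡1⇒m*n≡0 {zero}              _  = refl
m+n≡1⇒m*n≡0 {suc zero} {zero}   _  = refl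
m+n≡1⇒m*n≡0 {suc zero} {suc _}  ()
m+n≡1⇒m*n≡0 {suc (suc _)}       ()

module _ {n} (E : BipGraph n) (S : VSet n) where

  -- Deleting a vertex with at most one neighbour keeps |S| ≤ e(S); when none is left,
  -- every vertex has two neighbours and a non-backtracking walk finds a cycle.
  private
    peel : ∀ m s₁ s₂ → (∀ {v} → Member s₁ s₂ v → v ∈V S) →
           card s₁ + card s₂ ≡ suc m → suc m ≤ edges E s₁ s₂ → CycleIn E S
    peel zero s₁ s₂ _ size≡1 1≤e =
      ⊥-elim (<⇒≱ 1≤e (≤-trans (edges≤card*card E s₁ s₂)
                                (≤-reflexive (m+n≡1⇒m*n≡0 {card s₁} {card s₂} size≡1))))
    peel (suc m) s₁ s₂ ⊆S size≡ size≤e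
      with any? (λ i → (s₁ i ≟ᵇ true) ×-dec (degIn E s₂ i ≤? 1))
         | any? (λ j → (s₂ j ≟ᵇ true) ×-dec (degIn (E ᵀ) s₁ j ≤? 1))
    ... | yes (i , s₁ᵢ , dᵢ≤1) | _ =
      peel m (remove i s₁) s₂ ⊆S′
        (suc-injective (trans (cong (_+ card s₂) (sym (card-remove-member s₁ s₁ᵢ))) size≡))
        (s≤s⁻¹ (≤-trans size≤e (edges-remove₁ E s₁ s₂ i dᵢ≤1)))
      where
      ⊆S′ : ∀ {v} → Member (remove i s₁) s₂ v → v ∈V S
      ⊆S′ {inj₁ i′} r = ⊆S {inj₁ i′} (remove-⊆ s₁ i i′ r)
      ⊆S′ {inj₂ j}  s₂ⱼ = ⊆S {inj₂ j} s₂ⱼ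
    ... | no _ | yes (j , s₂ⱼ , dⱼ≤1) =
      peel m s₁ (remove j s₂) ⊆S′
        (suc-injective (trans (sym (+-suc _ _))
                              (trans (cong (card s₁ +_) (sym (card-remove-member s₂ s₂ⱼ))) size≡)))
        (s≤s⁻¹ (≤-trans size≤e (edges-remove₂ E s₁ s₂ j dⱼ≤1)))
      where
      ⊆S′ : ∀ {v} → Member s₁ (remove j s₂) v → v ∈V S
      ⊆S′ {inj₁ i}  s₁ᵢ = ⊆S {inj₁ i} s₁ᵢ
      ⊆S′ {inj₂ j′} r = ⊆S {inj₂ j′} (remove-⊆ s₂ j j′ r)
    ... | no ¬low₁ | no ¬low₂ with 0<edges⇒edge E s₁ s₂ (≤-trans (s≤s z≤n) size≤e)
    ...   | i , j , s₁ᵢ , s₂ⱼ , eᵢⱼ =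
      cycle-from-branching E S (Member s₁ s₂) ⊆S branching {inj₁ i} {inj₂ j} s₁ᵢ s₂ⱼ eᵢⱼ
      where
      branching : Branching E (Member s₁ s₂)
      branching {inj₁ i} {inj₂ j′} s₁ᵢ _ _
        with another-member _ (≰⇒> (λ d≤1 → ¬low₁ (i , s₁ᵢ , d≤1))) j′
      ... | j , j≢j′ , s₂ⱼ∧eᵢⱼ =
        inj₂ j , proj₁ (∧≡true s₂ⱼ∧eᵢⱼ) , proj₂ (∧≡true s₂ⱼ∧eᵢⱼ) , j≢j′ ∘ inj₂-injective
      branching {inj₂ j} {inj₁ i′} s₂ⱼ _ _
        with another-member _ (≰⇒> (λ d≤1 → ¬low₂ (j , s₂ⱼ , d≤1))) i′
      ... | i , i≢i′ , s₁ᵢ∧eᵢⱼ =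
        inj₁ i , proj₁ (∧≡true s₁ᵢ∧eᵢⱼ) , proj₂ (∧≡true s₁ᵢ∧eᵢⱼ) , i≢i′ ∘ inj₁-injective

  size≤edges⇒cycle : ∀ s₁ s₂ → (∀ {v} → Member s₁ s₂ v → v ∈V S) →
                     0 < card s₁ + card s₂ → card s₁ + card s₂ ≤ edges E s₁ s₂ → CycleIn E S
  size≤edges⇒cycle s₁ s₂ ⊆S 0<size size≤e with card s₁ + card s₂ in size≡
  ... | suc m = peel m s₁ s₂ ⊆S size≡ size≤e

-- With b = k + 2 + o, the equation b + b̄ = 2k + 1 forces k = o + b̄ + 1.
private
  edge-count-arithmetic′ : ∀ {k a b̄ o e} → k ≡ suc (o + b̄) →
    suc (suc (suc (2 * k))) ≤ a + (suc (suc k) + o) → a * suc (suc k) ≤ e + a * b̄ + 1 →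
    a + (suc (suc k) + o) ≤ e
  edge-count-arithmetic′ {a = a} {b̄} {o} {e} refl a+b-big count = +-cancelʳ-≤ 1 _ _ (begin
    a + b + 1                ≡⟨ +-assoc a b 1 ⟩
    a + (b + 1)              ≡⟨ cong (a +_) (b+1≡ o b̄) ⟩
    a + (2 * o + b̄ + 4)      ≤⟨ +-monoʳ-≤ a (subst (2 * o + b̄ + 4 ≤_) (sym (b̄+2*o+2≡ o b̄)) (m≤m+n _ _)) ⟩
    a + (b̄ + 2) * (o + 2)    ≤⟨ +-monoʳ-≤ a (*-monoˡ-≤ (o + 2) a-big) ⟩
    a + a * (o + 2)          ≡⟨ a+a*o+2≡ a o ⟩
    a * (o + 3)              ≤⟨ +-cancelˡ-≤ (a * b̄) _ _ (subst₂ _≤_ (a*k+2≡ a o b̄) (e+a*b̄+1≡ e a b̄) count) ⟩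
    e + 1                    ∎)
    where
    open ≤-Reasoning
    b : ℕ
    b = suc (suc (suc (o + b̄))) + o
    b+1≡ : ∀ o b̄ → suc (suc (suc (o + b̄))) + o + 1 ≡ 2 * o + b̄ + 4
    b+1≡ = solve-∀
    b̄+2*o+2≡ : ∀ o b̄ → (b̄ + 2) * (o + 2) ≡ 2 * o + b̄ + 4 + (b̄ * o + b̄)
    b̄+2*o+2≡ = solve-∀
    a+a*o+2≡ : ∀ a o → a + a * (o + 2) ≡ a * (o + 3)
    a+a*o+2≡ = solve-∀
    a*k+2≡ : ∀ a o b̄ → a * suc (suc (suc (o + b̄))) ≡ a * b̄ + a * (o + 3)
    a*k+2≡ = solve-∀
    e+a*b̄+1≡ : ∀ e a b̄ → e + a * b̄ + 1 ≡ a * b̄ + (e + 1)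
    e+a*b̄+1≡ = solve-∀
    a-big : b̄ + 2 ≤ a
    a-big = +-cancelʳ-≤ b (b̄ + 2) a (subst (_≤ a + b) (n+2≡ o b̄) a+b-big)
      where
      n+2≡ : ∀ o b̄ → suc (suc (suc (2 * suc (o + b̄)))) ≡ b̄ + 2 + (suc (suc (suc (o + b̄))) + o)
      n+2≡ = solve-∀

edge-count-arithmetic : ∀ {k a b b̄ e} → b + b̄ ≡ suc (2 * k) → suc (suc (suc (2 * k))) ≤ a + b →
  suc (suc k) ≤ b → a * suc (suc k) ≤ e + a * b̄ + 1 → a + b ≤ e
edge-count-arithmetic {k} {b̄ = b̄} b+b̄≡n a+b-big b-big count with m≤n⇒∃[o]m+o≡n b-big
... | o , refl = edge-count-arithmetic′ k≡ a+b-big count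
  where
  k≡ : k ≡ suc (o + b̄)
  k≡ = sym (suc-injective (+-cancelˡ-≡ k _ _ (trans (lhs k o b̄) (trans b+b̄≡n (rhs k)))))
    where
    lhs : ∀ k o b̄ → k + suc (suc (o + b̄)) ≡ suc (suc k) + o + b̄
    lhs = solve-∀
    rhs : ∀ k → suc (2 * k) ≡ k + suc k
    rhs = solve-∀

degree-sum-bound : ∀ {n} k (E : BipGraph n) → (∀ i → suc k ≤ deg₁ E i) → countDeg₁ E (suc k) ≤ 1 →
               ∀ s₁ s₂ → card s₁ * suc (suc k) ≤ edges E s₁ s₂ + card s₁ * card (not ∘ s₂) + 1
degree-sum-bound k E δ tight≤1 s₁ s₂ = begin
  card s₁ * suc (suc k)
    ≤⟨ card*suc≤sumOver (suc k) (deg₁ E) δ s₁ ⟩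
  sumOver s₁ (deg₁ E) + card (λ i → ⌊ deg₁ E i ≟ suc k ⌋)
    ≤⟨ +-monoʳ-≤ _ (subst (_≤ 1) (∣tabulate∣≡card (λ i → ⌊ deg₁ E i ≟ suc k ⌋)) tight≤1) ⟩
  sumOver s₁ (deg₁ E) + 1
    ≤⟨ +-monoˡ-≤ 1 (sumOver-mono-≤ s₁ (λ i _ → deg-split i)) ⟩
  sumOver s₁ (λ i → degIn E s₂ i + card (not ∘ s₂)) + 1
    ≡⟨ cong (_+ 1) (sumOver-+ s₁ (degIn E s₂) _) ⟩
  edges E s₁ s₂ + sumOver s₁ (λ _ → card (not ∘ s₂)) + 1
    ≡⟨ cong (λ x → edges E s₁ s₂ + x + 1) (sumOver-const s₁ _) ⟩
  edges E s₁ s₂ + card s₁ * card (not ∘ s₂) + 1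
    ∎
  where
  open ≤-Reasoning
  deg-split : ∀ i → deg₁ E i ≤ degIn E s₂ i + card (not ∘ s₂)
  deg-split i = subst (_≤ degIn E s₂ i + card (not ∘ s₂)) (sym (∣tabulate∣≡card (E i)))
                      (card≤card-∧+card-not s₂ (E i))

large-part⇒size≤edges : ∀ k (E : BipGraph (suc (2 * k))) →
                        (∀ i → suc k ≤ deg₁ E i) → countDeg₁ E (suc k) ≤ 1 →
                        ∀ s₁ s₂ → suc (suc (suc (2 * k))) ≤ card s₁ + card s₂ → suc (suc k) ≤ card s₂ →
                        card s₁ + card s₂ ≤ edges E s₁ s₂
large-part⇒size≤edges k E δ tight≤1 s₁ s₂ big s₂-big =
  edge-count-arithmetic {a = card s₁} {e = edges E s₁ s₂} (card+card-not s₂) big s₂-big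
                        (degree-sum-bound k E δ tight≤1 s₁ s₂)

large-sum⇒large-part : ∀ {k a b} → suc (suc (suc (2 * k))) ≤ a + b → suc (suc k) ≤ a ⊎ suc (suc k) ≤ b
large-sum⇒large-part {k} {a} {b} big with suc (suc k) ≤? a
... | yes a-big = inj₁ a-big
... | no  a-small = inj₂ (+-cancelˡ-≤ (suc k) _ _ (begin
  suc k + suc (suc k)     ≡⟨ n+2≡ k ⟩
  suc (suc (suc (2 * k))) ≤⟨ big ⟩
  a + b                   ≤⟨ +-monoˡ-≤ b (s≤s⁻¹ (≰⇒> a-small)) ⟩
  suc k + b               ∎))
  where
  open ≤-Reasoning
  n+2≡ : ∀ k → suc k + suc (suc k) ≡ suc (suc (suc (2 * k)))
  n+2≡ = solve-∀

cycle-meets-V₁-twice : ∀ {n} {E : BipGraph n} {S : VSet n} → CycleIn E S →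
                       ∃₂ λ i i′ → i ≢ i′ × inj₁ i ∈V S × inj₁ i′ ∈V S
cycle-meets-V₁-twice record { first = inj₁ _ ; rest = inj₂ _ ∷ inj₁ _ ∷ _
                            ; distinct = (_ ∷ i≢i′ ∷ _) ∷ _ ; inS = i∈ ∷ _ ∷ i′∈ ∷ _ } =
  _ , _ , i≢i′ ∘ cong inj₁ , i∈ , i′∈
cycle-meets-V₁-twice record { first = inj₂ _ ; rest = inj₁ _ ∷ inj₁ _ ∷ _ ; walk = cons _ _ _ _ (cons _ _ _ () _) }
cycle-meets-V₁-twice record { first = inj₂ _ ; rest = inj₁ _ ∷ inj₂ _ ∷ [] ; lastIsLast = refl ; closes = () }
cycle-meets-V₁-twice record { first = inj₂ _ ; rest = inj₁ _ ∷ inj₂ _ ∷ inj₁ _ ∷ _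
                            ; distinct = _ ∷ (_ ∷ i≢i′ ∷ _) ∷ _ ; inS = _ ∷ i∈ ∷ _ ∷ i′∈ ∷ _ } =
  _ , _ , i≢i′ ∘ cong inj₁ , i∈ , i′∈
cycle-meets-V₁-twice record { first = inj₂ _ ; rest = inj₁ _ ∷ inj₂ _ ∷ inj₂ _ ∷ _
                            ; walk = cons _ _ _ _ (cons _ _ _ _ (cons _ _ _ () _)) }
cycle-meets-V₁-twice record { first = inj₁ _ ; rest = inj₁ _ ∷ _ ; walk = cons _ _ _ () _ }
cycle-meets-V₁-twice record { first = inj₂ _ ; rest = inj₂ _ ∷ _ ; walk = cons _ _ _ () _ }
cycle-meets-V₁-twice record { first = inj₁ _ ; rest = inj₂ _ ∷ inj₂ _ ∷ _ ; walk = cons _ _ _ _ (cons _ _ _ () _) }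
cycle-meets-V₁-twice record { rest = [] ; long = s≤s () }
cycle-meets-V₁-twice record { rest = _ ∷ [] ; long = s≤s (s≤s ()) }

star : ∀ m → VSet (suc m)
star m = ⁅ zero ⁆ , ⊤

star-acyclic : ∀ {m} (E : BipGraph (suc m)) → IsForest E (star m)
star-acyclic E cycle with cycle-meets-V₁-twice cycle
... | i , i′ , i≢i′ , i∈ , i′∈ = i≢i′ (trans (x∈⁅y⁆⇒x≡y zero i∈) (sym (x∈⁅y⁆⇒x≡y zero i′∈)))

size-star : ∀ m → size (star m) ≡ suc (suc m)
size-star m = cong₂ (λ x y → suc x + y) (∣⊥∣≡0 m) (∣⊤∣≡n (suc m))

forest-size≤ : (k : ℕ) → (E : BipGraph (suc (2 * k)))
  → (∀ i → suc k ≤ deg₁ E i) → (∀ j → suc k ≤ deg₂ E j)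
  → countDeg₁ E (suc k) ≤ 1 → countDeg₂ E (suc k) ≤ 1
  → ∀ S → IsForest E S → size S ≤ suc (suc (2 * k))
forest-size≤ k E δ₁ δ₂ tight₁ tight₂ S@(S₁ , S₂) acyclic with size S ≤? suc (suc (2 * k))
... | yes small = small
... | no  large = ⊥-elim (acyclic (size≤edges⇒cycle E S s₁ s₂ ⊆S (≤-trans (s≤s z≤n) big) dense))
  where
  s₁ s₂ : Fin (suc (2 * k)) → Bool
  s₁ = lookup S₁
  s₂ = lookup S₂
  big : suc (suc (suc (2 * k))) ≤ card s₁ + card s₂
  big = subst (suc (suc (suc (2 * k))) ≤_) (cong₂ _+_ (∣p∣≡card S₁) (∣p∣≡card S₂)) (≰⇒> large)
  ⊆S : ∀ {v} → Member s₁ s₂ v → v ∈V S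
  ⊆S {inj₁ i} = lookup⇒[]= i S₁
  ⊆S {inj₂ j} = lookup⇒[]= j S₂
  dense : card s₁ + card s₂ ≤ edges E s₁ s₂
  dense with large-sum⇒large-part {k} {card s₁} big
  ... | inj₂ s₂-big = large-part⇒size≤edges k E δ₁ tight₁ s₁ s₂ big s₂-big
  ... | inj₁ s₁-big = subst₂ _≤_ (+-comm (card s₂) (card s₁)) (sym (edges-transpose E s₁ s₂))
                        (large-part⇒size≤edges k (E ᵀ) δ₂ tight₂ s₂ s₁ big′ s₁-big)
    where
    big′ : suc (suc (suc (2 * k))) ≤ card s₂ + card s₁
    big′ = subst (suc (suc (suc (2 * k))) ≤_) (+-comm (card s₁) (card s₂)) big

theorem6 : (k : ℕ) → (E : BipGraph (suc (2 * k)))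
    → (∀ i → suc k ≤ deg₁ E i) → (∀ j → suc k ≤ deg₂ E j)
    → countDeg₁ E (suc k) ≤ 1 → countDeg₂ E (suc k) ≤ 1
    → ForestNumber E (suc (suc (2 * k)))
theorem6 k E δ₁ δ₂ tight₁ tight₂ =
  (star (2 * k) , star-acyclic E , size-star (2 * k)) , forest-size≤ k E δ₁ δ₂ tight₁ tight₂
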